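{- Fix integers $k\ge 2$ and $m\ge 1$. For $i=1,\dots,m$ let $M_i=\{k(i-1)+1,\dots,ki\}$ and $V_j=\{1,\dots,kj\}$. Define $k$-uniform hypergraphs $\mathcal{H}^*_j=(V_j,\mathcal{E}_j)$ recursively by $\mathcal{E}_0=\emptyset$ and, for $j\ge 1$, $$\mathcal{E}_j=\mathcal{E}_{j-1}\cup\left\{E\in\binom{V_j}{k} : E\cap M_j\neq\emptyset,\ kj\notin E\right\}\cup\{M_j\}.$$ Then $|\mathcal{E}_m| = f(k,m)$, where $$f(k,m) = m + \sum_{\ell=2}^{k} b_{k,\ell}\binom{m}{\ell},\qquad b_{k,\ell} = \frac{\ell-1}{\ell}\sum_{i=0}^{\ell-1}(-1)^{i}\binom{\ell}{i}\binom{k(\ell-i)}{k}.$$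
   Context: $\binom{V}{k}$ denotes the set of all $k$-element subsets of $V$; a $k$-uniform hypergraph on vertex set $V$ has edge set contained in $\binom{V}{k}$. -}

module Defs where

open import Data.Bool using (Bool; true; false; _∧_; _∨_; not)
open import Data.Nat as ℕ using (ℕ; zero; suc; _*_; _∸_; _≤ᵇ_; _<ᵇ_; _≡ᵇ_; NonZero)
open import Data.Nat.Combinatorics using (_C_)
open import Data.Fin using (Fin; toℕ)
open import Data.Fin.Subset using (Subset; _∩_; ∣_∣; inside; outside)
open import Data.Fin.Subset.Properties using (_⊆?_; nonempty?)
open import Data.Vec as Vec using (Vec; []; _∷_; tabulate; lookup)
open import Data.Vec.Properties using (≡-dec)
open import Data.Bool.Properties using () renaming (_≟_ to _≟𝔹_)
open import Data.List as List using (List; []; _∷_; _++_; upTo; filter; length)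
open import Data.Integer as ℤ using (ℤ; +_; -1ℤ)
open import Data.Rational as ℚ using (ℚ)
open import Relation.Nullary.Decidable using (⌊_⌋)
open import Data.Bool.ListAction using (any)

-- Vertices 1..n of the ambient vertex set are represented by Fin n:
-- the index i : Fin n stands for the vertex (toℕ i + 1).
-- Edges (sets of vertices) are subsets of Fin n (Data.Fin.Subset).

Vset : ∀ {n} → (k j : ℕ) → Subset n
Vset k j = tabulate (λ i → toℕ i <ᵇ k * j)

-- M_j = {k(j-1)+1,...,kj}, for j ≥ 1 (j = suc j')
Mset : ∀ {n} → (k j' : ℕ) → Subset n
Mset k j' = tabulate (λ i → (k * j' ≤ᵇ toℕ i) ∧ (toℕ i <ᵇ k * suc j'))

vertexIn : ∀ {n} → ℕ → Subset n → Bool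
vertexIn {n} v E = any (λ i → lookup E i ∧ (suc (toℕ i) ≡ᵇ v)) (List.allFin n)

inBinom : ∀ {n} → (k j : ℕ) → Subset n → Bool
inBinom k j E = ⌊ E ⊆? Vset k j ⌋ ∧ (∣ E ∣ ≡ᵇ k)

isEdge : ∀ {n} → (k j : ℕ) → Subset n → Bool
isEdge k zero E = false
isEdge k (suc j) E =
  isEdge k j E
  ∨ (inBinom k (suc j) E ∧ ⌊ nonempty? (E ∩ Mset k j) ⌋ ∧ not (vertexIn (k * suc j) E))
  ∨ ⌊ ≡-dec _≟𝔹_ E (Mset k j) ⌋

allSubsets : (n : ℕ) → List (Subset n)
allSubsets zero = [] ∷ []
allSubsets (suc n) = List.map (outside ∷_) (allSubsets n) ++ List.map (inside ∷_) (allSubsets n)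

numEdges : (k m : ℕ) → ℕ
numEdges k m = length (filter (λ E → isEdge k m E Data.Bool.≟ true) (allSubsets (k * m)))

innerSum : (k ℓ : ℕ) → ℤ
innerSum k ℓ = List.foldr ℤ._+_ (+ 0)
  (List.map (λ i → (-1ℤ ℤ.^ i) ℤ.* (+ (ℓ C i)) ℤ.* (+ ((k * (ℓ ∸ i)) C k))) (upTo ℓ))

b : (k ℓ : ℕ) → .{{_ : NonZero ℓ}} → ℚ
b k ℓ = ((+ (ℓ ∸ 1)) ℚ./ ℓ) ℚ.* ((innerSum k ℓ) ℚ./ 1)

f : (k m : ℕ) → ℚ
f k m = ((+ m) ℚ./ 1) ℚ.+
  List.foldr ℚ._+_ ℚ.0ℚ
    (List.map (λ x → b k (2 ℕ.+ x) ℚ.* ((+ (m C (2 ℕ.+ x))) ℚ./ 1)) (upTo (k ∸ 1)))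

-- Write k = K + 1, c(j) = C(kj, k) and e(j) = C(kj + K, K), and let N(j) be the number of edges
-- of H*_j. Passing from H*_j to H*_{j+1} adds M_{j+1} together with the k-subsets of
-- {1, ..., kj + K} that are not contained in {1, ..., kj}, so
--   N(j + 1) + c(j) = N(j) + 1 + C(kj + K, k).
-- The sequence e is a polynomial of degree K in j, so Newton's forward-difference formula writes
-- it in the basis j ↦ C(j, s) with coefficients ê(s) = Δ^s e(0); the absorption identity
-- c(j + 1) = (j + 1) e(j) then gives Δ^{s+1} c(0) = (s + 1) ê(s). The alternating sum in b_{k,ℓ}
-- is Δ^ℓ c(0), so b_{k,ℓ} = (ℓ - 1) ê(ℓ - 1), and f(k, m) = m + Σ_s s ê(s) C(m, s + 1).
-- Pascal's rule shows that this closed form satisfies the same recursion as N.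

module Submission where

open import Defs
open import Data.Nat using (ℕ; _≤_)
open import Data.Integer using (+_)
open import Data.Rational using (_/_)
open import Relation.Binary.PropositionalEquality using (_≡_)

open import Data.Bool using (Bool; true; false; T; if_then_else_; _∧_; _∨_; not)
import Data.Bool.Properties as Bool
open import Data.Bool.Properties using () renaming (_≟_ to _≟𝔹_)
open import Data.Empty using (⊥-elim)
open import Data.Fin using (Fin; toℕ)
open import Data.Fin.Properties using (toℕ-fromℕ<)
open import Data.Fin.Subset using (Subset; inside; outside; ∣_∣; _∈_; _⊆_; _∩_)
open import Data.Fin.Subset.Properties using (_⊆?_; ⊆-trans; nonempty?; x∈p∩q⁺; x∈p∩q⁻)
open import Data.Integer as ℤ using (ℤ; 0ℤ; 1ℤ; -1ℤ)
  renaming (_+_ to _+ᶻ_; _*_ to _*ᶻ_; _-_ to _-ᶻ_)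
import Data.Integer.Properties as ℤ
open import Data.Integer.Tactic.RingSolver using (solve-∀)
open import Data.List as List using (List; []; _∷_; length; filter)
import Data.List.Properties as List
open import Data.List.Membership.Propositional using (lose)
open import Data.List.Membership.Propositional.Properties using (∈-allFin)
open import Data.List.Relation.Unary.Any using (satisfied)
open import Data.List.Relation.Unary.Any.Properties using (any⁺; any⁻)
open import Data.Nat as ℕ using (zero; suc; _+_; _*_; _∸_; _<_; z≤n; s≤s; _≡ᵇ_; _<ᵇ_; _≤ᵇ_)
import Data.Nat.Properties as ℕ
open import Data.Nat.Combinatorics using (_C_; nCk+nC[k+1]≡[n+1]C[k+1]; nC1≡n)
import Data.Nat.Tactic.RingSolver as ℕ-Solver
open import Data.Product using (∃; _×_; _,_; proj₁; proj₂)
open import Data.Rational as ℚ using (ℚ; fromℚᵘ)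
import Data.Rational.Properties as ℚ
open import Data.Rational.Unnormalised as ℚᵘ using (mkℚᵘ; *≡*)
import Data.Rational.Unnormalised.Properties as ℚᵘ
open import Data.Sum using (inj₁; inj₂)
open import Data.Vec using ([]; _∷_; tabulate)
open import Data.Vec.Properties using (≡-dec; lookup∘tabulate; []=⇒lookup; lookup⇒[]=)
open import Function using (_∘_)
open import Function.Bundles using (Equivalence)
open import Relation.Binary.PropositionalEquality
  using (refl; sym; trans; cong; cong₂; subst; module ≡-Reasoning)
open import Relation.Nullary using (¬_; yes; no)
open import Relation.Nullary.Decidable using (⌊_⌋; does; isYes≗does; toWitness; fromWitness)

open import Algebra.Properties.AbelianGroup ℤ.+-0-abelianGroup using (∙-cancelʳ)
open import Algebra.Properties.CommutativeSemigroup ℕ.+-commutativeSemigroup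
  using () renaming (interchange to +-interchange)
open import Algebra.Properties.Ring ℤ.+-*-ring using (x[y-z]≈xy-xz)

choose : ℕ → ℕ → ℕ
choose zero    zero    = 1
choose zero    (suc r) = 0
choose (suc n) zero    = 1
choose (suc n) (suc r) = choose n r + choose n (suc r)

C≡choose : ∀ n r → n C r ≡ choose n r
C≡choose zero    zero    = refl
C≡choose zero    (suc r) = refl
C≡choose (suc n) zero    = refl
C≡choose (suc n) (suc r) =
  trans (sym (nCk+nC[k+1]≡[n+1]C[k+1] n r)) (cong₂ _+_ (C≡choose n r) (C≡choose n (suc r)))

choose-zeroʳ : ∀ n → choose n 0 ≡ 1
choose-zeroʳ zero    = refl
choose-zeroʳ (suc n) = refl

choose-oneʳ : ∀ n → choose n 1 ≡ n
choose-oneʳ n = trans (sym (C≡choose n 1)) (nC1≡n n)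

choose-< : ∀ {n r} → n < r → choose n r ≡ 0
choose-< {zero}  {suc r} _         = refl
choose-< {suc n} {suc r} (s≤s n<r) = cong₂ _+_ (choose-< n<r) (choose-< (ℕ.m<n⇒m<1+n n<r))

choose-absorb : ∀ n r → suc r * choose (suc n) (suc r) ≡ suc n * choose n r
choose-absorb zero    zero    = refl
choose-absorb zero    (suc r) = ℕ.*-zeroʳ (2 + r)
choose-absorb (suc n) zero    = begin
  1 * (1 + choose (suc n) 1)  ≡⟨ ℕ.*-identityˡ _ ⟩
  suc (choose (suc n) 1)      ≡⟨ cong suc (choose-oneʳ (suc n)) ⟩
  2 + n                       ≡⟨ ℕ.*-identityʳ (2 + n) ⟨
  (2 + n) * 1                 ∎
  where open ≡-Reasoning
choose-absorb (suc n) (suc r) = begin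
  (2 + r) * (x + y)
    ≡⟨ ℕ.*-distribˡ-+ (2 + r) x y ⟩
  (x + suc r * x) + (2 + r) * y
    ≡⟨ cong₂ (λ u v → (x + u) + v) (choose-absorb n r) (choose-absorb n (suc r)) ⟩
  (x + suc n * choose n r) + suc n * choose n (suc r)
    ≡⟨ ℕ.+-assoc x _ _ ⟩
  x + (suc n * choose n r + suc n * choose n (suc r))
    ≡⟨ cong (λ z → x + z) (ℕ.*-distribˡ-+ (suc n) (choose n r) _) ⟨
  x + suc n * x
    ∎
  where
  open ≡-Reasoning
  x = choose (suc n) (suc r)
  y = choose (suc n) (2 + r)

∑ : ℕ → (ℕ → ℤ) → ℤ
∑ zero    h = 0ℤ
∑ (suc n) h = h 0 +ᶻ ∑ n (h ∘ suc)

∑-cong-< : ∀ n {g h : ℕ → ℤ} → (∀ i → i < n → g i ≡ h i) → ∑ n g ≡ ∑ n h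
∑-cong-< zero    eq = refl
∑-cong-< (suc n) eq =
  cong₂ _+ᶻ_ (eq 0 (s≤s z≤n)) (∑-cong-< n (λ i i<n → eq (suc i) (s≤s i<n)))

∑-cong : ∀ n {g h : ℕ → ℤ} → (∀ i → g i ≡ h i) → ∑ n g ≡ ∑ n h
∑-cong n eq = ∑-cong-< n (λ i _ → eq i)

∑-zero : ∀ n {h : ℕ → ℤ} → (∀ i → h i ≡ 0ℤ) → ∑ n h ≡ 0ℤ
∑-zero zero    eq = refl
∑-zero (suc n) eq = cong₂ _+ᶻ_ (eq 0) (∑-zero n (eq ∘ suc))

∑-distrib-+ : ∀ n (g h : ℕ → ℤ) → ∑ n (λ i → g i +ᶻ h i) ≡ ∑ n g +ᶻ ∑ n h
∑-distrib-+ zero    g h = refl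
∑-distrib-+ (suc n) g h =
  trans (cong (g 0 +ᶻ h 0 +ᶻ_) (∑-distrib-+ n (g ∘ suc) (h ∘ suc))) (swap (g 0) (h 0) _ _)
  where
  swap : ∀ a b c d → (a +ᶻ b) +ᶻ (c +ᶻ d) ≡ (a +ᶻ c) +ᶻ (b +ᶻ d)
  swap = solve-∀

∑-distrib-- : ∀ n (g h : ℕ → ℤ) → ∑ n (λ i → g i -ᶻ h i) ≡ ∑ n g -ᶻ ∑ n h
∑-distrib-- zero    g h = refl
∑-distrib-- (suc n) g h =
  trans (cong (g 0 -ᶻ h 0 +ᶻ_) (∑-distrib-- n (g ∘ suc) (h ∘ suc))) (swap (g 0) (h 0) _ _)
  where
  swap : ∀ a b c d → (a -ᶻ b) +ᶻ (c -ᶻ d) ≡ (a +ᶻ c) -ᶻ (b +ᶻ d)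
  swap = solve-∀

*-distribˡ-∑ : ∀ n r (h : ℕ → ℤ) → r *ᶻ ∑ n h ≡ ∑ n (λ i → r *ᶻ h i)
*-distribˡ-∑ zero    r h = ℤ.*-zeroʳ r
*-distribˡ-∑ (suc n) r h =
  trans (ℤ.*-distribˡ-+ r (h 0) _) (cong (r *ᶻ h 0 +ᶻ_) (*-distribˡ-∑ n r (h ∘ suc)))

∑-last : ∀ n (h : ℕ → ℤ) → ∑ (suc n) h ≡ ∑ n h +ᶻ h n
∑-last zero    h = trans (ℤ.+-identityʳ (h 0)) (sym (ℤ.+-identityˡ (h 0)))
∑-last (suc n) h = trans (cong (h 0 +ᶻ_) (∑-last n (h ∘ suc))) (sym (ℤ.+-assoc (h 0) _ _))

δ : ℕ → ℕ → ℤ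
δ zero    zero    = 1ℤ
δ zero    (suc t) = 0ℤ
δ (suc s) zero    = 0ℤ
δ (suc s) (suc t) = δ s t

∑-δ : ∀ {n s} (h : ℕ → ℤ) → s < n → ∑ n (λ t → h t *ᶻ δ s t) ≡ h s
∑-δ {suc n} {zero}  h _ = begin
  h 0 *ᶻ 1ℤ +ᶻ ∑ n (λ t → h (suc t) *ᶻ 0ℤ)
    ≡⟨ cong₂ _+ᶻ_ (ℤ.*-identityʳ (h 0)) (∑-zero n (ℤ.*-zeroʳ ∘ h ∘ suc)) ⟩
  h 0 +ᶻ 0ℤ
    ≡⟨ ℤ.+-identityʳ (h 0) ⟩
  h 0
    ∎
  where open ≡-Reasoning
∑-δ {suc n} {suc s} h (s≤s s<n) =
  trans (cong₂ _+ᶻ_ (ℤ.*-zeroʳ (h 0)) (∑-δ (h ∘ suc) s<n)) (ℤ.+-identityˡ (h (suc s)))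

foldr-applyUpTo : ∀ n (f : ℕ → ℕ) (h : ℕ → ℤ) →
                  List.foldr _+ᶻ_ 0ℤ (List.map h (List.applyUpTo f n)) ≡ ∑ n (h ∘ f)
foldr-applyUpTo zero    f h = refl
foldr-applyUpTo (suc n) f h = cong (h (f 0) +ᶻ_) (foldr-applyUpTo n (f ∘ suc) h)

Δ : (ℕ → ℤ) → ℕ → ℤ
Δ g j = g (suc j) -ᶻ g j

Δ^ : ℕ → (ℕ → ℤ) → ℕ → ℤ
Δ^ zero    g = g
Δ^ (suc ℓ) g = Δ^ ℓ (Δ g)

Δ^-cong : ∀ ℓ {g h : ℕ → ℤ} → (∀ j → g j ≡ h j) → ∀ j → Δ^ ℓ g j ≡ Δ^ ℓ h j
Δ^-cong zero    eq = eq
Δ^-cong (suc ℓ) eq = Δ^-cong ℓ (λ j → cong₂ _-ᶻ_ (eq (suc j)) (eq j))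

Δ^-+ : ∀ ℓ (g h : ℕ → ℤ) j → Δ^ ℓ (λ i → g i +ᶻ h i) j ≡ Δ^ ℓ g j +ᶻ Δ^ ℓ h j
Δ^-+ zero    g h j = refl
Δ^-+ (suc ℓ) g h j =
  trans (Δ^-cong ℓ (λ i → swap (g (suc i)) (h (suc i)) (g i) (h i)) j) (Δ^-+ ℓ (Δ g) (Δ h) j)
  where
  swap : ∀ a b c d → (a +ᶻ b) -ᶻ (c +ᶻ d) ≡ (a -ᶻ c) +ᶻ (b -ᶻ d)
  swap = solve-∀

Δ^-* : ∀ ℓ r (g : ℕ → ℤ) j → Δ^ ℓ (λ i → r *ᶻ g i) j ≡ r *ᶻ Δ^ ℓ g j
Δ^-* zero    r g j = refl
Δ^-* (suc ℓ) r g j =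
  trans (Δ^-cong ℓ (λ i → sym (x[y-z]≈xy-xz r (g (suc i)) (g i))) j) (Δ^-* ℓ r (Δ g) j)

Δ^-const-zero : ∀ ℓ j → Δ^ ℓ (λ _ → 0ℤ) j ≡ 0ℤ
Δ^-const-zero zero    j = refl
Δ^-const-zero (suc ℓ) j = Δ^-const-zero ℓ j

Δ^-∑ : ∀ ℓ n (h : ℕ → ℕ → ℤ) j → Δ^ ℓ (λ i → ∑ n (λ t → h t i)) j ≡ ∑ n (λ t → Δ^ ℓ (h t) j)
Δ^-∑ ℓ zero    h j = Δ^-const-zero ℓ j
Δ^-∑ ℓ (suc n) h j =
  trans (Δ^-+ ℓ (h 0) _ j) (cong (Δ^ ℓ (h 0) j +ᶻ_) (Δ^-∑ ℓ n (h ∘ suc) j))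

Δ-choose : ∀ t j → Δ (λ i → + choose i (suc t)) j ≡ + choose j t
Δ-choose t j =
  trans (cong (_-ᶻ + choose j (suc t)) (ℤ.pos-+ (choose j t) (choose j (suc t))))
        (cancel (+ choose j t) (+ choose j (suc t)))
  where
  cancel : ∀ a b → a +ᶻ b -ᶻ b ≡ a
  cancel = solve-∀

Δ^-choose : ∀ ℓ t → Δ^ ℓ (λ j → + choose j t) 0 ≡ δ ℓ t
Δ^-choose zero    zero    = refl
Δ^-choose zero    (suc t) = refl
Δ^-choose (suc ℓ) zero    =
  trans (Δ^-cong ℓ (λ j → cong₂ (λ a b → + a -ᶻ + b) (choose-zeroʳ (suc j)) (choose-zeroʳ j)) 0)
        (Δ^-const-zero ℓ 0)
Δ^-choose (suc ℓ) (suc t) = trans (Δ^-cong ℓ (Δ-choose t) 0) (Δ^-choose ℓ t)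

Δ-∑-choose : ∀ n (a : ℕ → ℤ) j →
             Δ (λ i → ∑ n (λ s → a s *ᶻ + choose i (suc s))) j ≡ ∑ n (λ s → a s *ᶻ + choose j s)
Δ-∑-choose n a j = begin
  ∑ n (λ s → a s *ᶻ + choose (suc j) (suc s)) -ᶻ ∑ n (λ s → a s *ᶻ + choose j (suc s))
    ≡⟨ ∑-distrib-- n _ _ ⟨
  ∑ n (λ s → a s *ᶻ + choose (suc j) (suc s) -ᶻ a s *ᶻ + choose j (suc s))
    ≡⟨ ∑-cong n (λ s → trans (sym (x[y-z]≈xy-xz (a s) _ _)) (cong (a s *ᶻ_) (Δ-choose s j))) ⟩
  ∑ n (λ s → a s *ᶻ + choose j s)
    ∎
  where open ≡-Reasoning

hockey-stick : ∀ n u r →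
               + choose (n + u) (suc r) -ᶻ + choose n (suc r) ≡ ∑ u (λ t → + choose (n + t) r)
hockey-stick n zero r =
  trans (cong (λ m → + choose m (suc r) -ᶻ + choose n (suc r)) (ℕ.+-identityʳ n))
        (ℤ.+-inverseʳ (+ choose n (suc r)))
hockey-stick n (suc u) r = begin
  + choose (n + suc u) (suc r) -ᶻ + choose n (suc r)
    ≡⟨ cong (λ m → + choose m (suc r) -ᶻ + choose n (suc r)) (ℕ.+-suc n u) ⟩
  + choose (suc n + u) (suc r) -ᶻ + choose n (suc r)
    ≡⟨ split (+ choose (suc n + u) (suc r)) (+ choose (suc n) (suc r)) (+ choose n (suc r)) ⟩
  Δ (λ i → + choose i (suc r)) n +ᶻ (+ choose (suc n + u) (suc r) -ᶻ + choose (suc n) (suc r))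
    ≡⟨ cong₂ _+ᶻ_ (Δ-choose r n) (hockey-stick (suc n) u r) ⟩
  + choose n r +ᶻ ∑ u (λ t → + choose (suc n + t) r)
    ≡⟨ cong₂ _+ᶻ_ (cong (λ m → + choose m r) (sym (ℕ.+-identityʳ n)))
                  (∑-cong u (λ t → cong (λ m → + choose m r) (sym (ℕ.+-suc n t)))) ⟩
  ∑ (suc u) (λ t → + choose (n + t) r)
    ∎
  where
  open ≡-Reasoning
  split : ∀ x y z → x -ᶻ z ≡ (y -ᶻ z) +ᶻ (x -ᶻ y)
  split = solve-∀

-- Polynomial sequences and Newton's forward-difference formula

Degree< : ℕ → (ℕ → ℤ) → Set
Degree< d g = ∀ j → Δ^ d g j ≡ 0ℤ

Degree<-cong : ∀ d {g h : ℕ → ℤ} → (∀ j → g j ≡ h j) → Degree< d g → Degree< d h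
Degree<-cong d eq deg j = trans (sym (Δ^-cong d eq j)) (deg j)

Degree<-∑ : ∀ d n (h : ℕ → ℕ → ℤ) → (∀ t → Degree< d (h t)) →
            Degree< d (λ j → ∑ n (λ t → h t j))
Degree<-∑ d n h deg j = trans (Δ^-∑ d n h j) (∑-zero n (λ t → deg t j))

Degree<-choose : ∀ k a r → Degree< (suc r) (λ j → + choose (k * j + a) r)
Degree<-choose k a zero    j =
  cong₂ (λ x y → + x -ᶻ + y) (choose-zeroʳ (k * suc j + a)) (choose-zeroʳ (k * j + a))
Degree<-choose k a (suc r) =
  Degree<-cong (suc r) Δ≡∑
    (Degree<-∑ (suc r) k (λ t j → + choose (k * j + (a + t)) r) (λ t → Degree<-choose k (a + t) r))
  where
  shift : ∀ k j a → k * j + a + k ≡ k * suc j + a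
  shift = ℕ-Solver.solve-∀
  Δ≡∑ : ∀ j → ∑ k (λ t → + choose (k * j + (a + t)) r) ≡ Δ (λ i → + choose (k * i + a) (suc r)) j
  Δ≡∑ j = begin
    ∑ k (λ t → + choose (k * j + (a + t)) r)
      ≡⟨ ∑-cong k (λ t → cong (λ m → + choose m r) (ℕ.+-assoc (k * j) a t)) ⟨
    ∑ k (λ t → + choose (k * j + a + t) r)
      ≡⟨ hockey-stick (k * j + a) k r ⟨
    + choose (k * j + a + k) (suc r) -ᶻ + choose (k * j + a) (suc r)
      ≡⟨ cong (λ m → + choose m (suc r) -ᶻ + choose (k * j + a) (suc r)) (shift k j a) ⟩
    Δ (λ i → + choose (k * i + a) (suc r)) j
      ∎
    where open ≡-Reasoning

newtonSum : ℕ → (ℕ → ℤ) → ℕ → ℤ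
newtonSum d g j = ∑ d (λ ℓ → + choose j ℓ *ᶻ Δ^ ℓ g 0)

newtonSum-suc : ∀ d g j →
                newtonSum (suc d) g (suc j) ≡ newtonSum (suc d) g j +ᶻ newtonSum d (Δ g) j
newtonSum-suc d g j = begin
  1ℤ *ᶻ g 0 +ᶻ ∑ d (λ ℓ → + (choose j ℓ + choose j (suc ℓ)) *ᶻ Δ^ ℓ (Δ g) 0)
    ≡⟨ cong (1ℤ *ᶻ g 0 +ᶻ_) (trans (∑-cong d pascal) (∑-distrib-+ d _ _)) ⟩
  1ℤ *ᶻ g 0 +ᶻ (newtonSum d (Δ g) j +ᶻ higher)
    ≡⟨ reassoc (g 0) (newtonSum d (Δ g) j) higher ⟩
  (1ℤ *ᶻ g 0 +ᶻ higher) +ᶻ newtonSum d (Δ g) j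
    ≡⟨ cong (λ x → (+ x *ᶻ g 0 +ᶻ higher) +ᶻ newtonSum d (Δ g) j) (choose-zeroʳ j) ⟨
  newtonSum (suc d) g j +ᶻ newtonSum d (Δ g) j
    ∎
  where
  open ≡-Reasoning
  higher : ℤ
  higher = ∑ d (λ ℓ → + choose j (suc ℓ) *ᶻ Δ^ (suc ℓ) g 0)
  pascal : ∀ ℓ → + (choose j ℓ + choose j (suc ℓ)) *ᶻ Δ^ ℓ (Δ g) 0
               ≡ + choose j ℓ *ᶻ Δ^ ℓ (Δ g) 0 +ᶻ + choose j (suc ℓ) *ᶻ Δ^ ℓ (Δ g) 0
  pascal ℓ = trans (cong (_*ᶻ Δ^ ℓ (Δ g) 0) (ℤ.pos-+ (choose j ℓ) (choose j (suc ℓ))))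
                   (ℤ.*-distribʳ-+ _ (+ choose j ℓ) (+ choose j (suc ℓ)))
  reassoc : ∀ x y z → 1ℤ *ᶻ x +ᶻ (y +ᶻ z) ≡ (1ℤ *ᶻ x +ᶻ z) +ᶻ y
  reassoc = solve-∀

newton : ∀ d g → Degree< d g → ∀ j → g j ≡ newtonSum d g j
newton zero    g deg j       = deg j
newton (suc d) g deg zero    = begin
  g 0              ≡⟨ ℤ.*-identityˡ (g 0) ⟨
  1ℤ *ᶻ g 0        ≡⟨ ℤ.+-identityʳ _ ⟨
  1ℤ *ᶻ g 0 +ᶻ 0ℤ  ≡⟨ cong (1ℤ *ᶻ g 0 +ᶻ_) (∑-zero d (λ ℓ → ℤ.*-zeroˡ (Δ^ (suc ℓ) g 0))) ⟨
  newtonSum (suc d) g 0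
    ∎
  where open ≡-Reasoning
newton (suc d) g deg (suc j) = begin
  g (suc j)
    ≡⟨ split (g (suc j)) (g j) ⟩
  g j +ᶻ Δ g j
    ≡⟨ cong₂ _+ᶻ_ (newton (suc d) g deg j) (newton d (Δ g) deg j) ⟩
  newtonSum (suc d) g j +ᶻ newtonSum d (Δ g) j
    ≡⟨ newtonSum-suc d g j ⟨
  newtonSum (suc d) g (suc j)
    ∎
  where
  open ≡-Reasoning
  split : ∀ x y → x ≡ y +ᶻ (x -ᶻ y)
  split = solve-∀

-- Iterated differences as alternating sums

alternatingSum : ℕ → (ℕ → ℤ) → ℤ
alternatingSum ℓ g = ∑ (suc ℓ) (λ i → -1ℤ ℤ.^ i *ᶻ + choose ℓ i *ᶻ g (ℓ ∸ i))

alternatingSum-suc : ∀ ℓ g → alternatingSum (suc ℓ) g ≡ alternatingSum ℓ (Δ g)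
alternatingSum-suc ℓ g = begin
  alternatingSum (suc ℓ) g
    ≡⟨ cong₂ _+ᶻ_ W-first (trans (∑-cong (suc ℓ) pascal) (∑-distrib-- (suc ℓ) Q P)) ⟩
  W 0 +ᶻ (∑ (suc ℓ) Q -ᶻ ∑ (suc ℓ) P)
    ≡⟨ ℤ.+-assoc (W 0) (∑ (suc ℓ) Q) _ ⟨
  ∑ (2 + ℓ) W -ᶻ ∑ (suc ℓ) P
    ≡⟨ cong (_-ᶻ ∑ (suc ℓ) P) (trans (∑-last (suc ℓ) W) (cong (∑ (suc ℓ) W +ᶻ_) W-last)) ⟩
  ∑ (suc ℓ) W +ᶻ 0ℤ -ᶻ ∑ (suc ℓ) P
    ≡⟨ cong (_-ᶻ ∑ (suc ℓ) P) (trans (ℤ.+-identityʳ _) (∑-cong-< (suc ℓ) W≡R)) ⟩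
  ∑ (suc ℓ) R -ᶻ ∑ (suc ℓ) P
    ≡⟨ ∑-distrib-- (suc ℓ) R P ⟨
  ∑ (suc ℓ) (λ i → R i -ᶻ P i)
    ≡⟨ ∑-cong (suc ℓ) (λ i → sym (x[y-z]≈xy-xz (sign i) (g (suc (ℓ ∸ i))) (g (ℓ ∸ i)))) ⟩
  alternatingSum ℓ (Δ g)
    ∎
  where
  open ≡-Reasoning
  sign : ℕ → ℤ
  sign i = -1ℤ ℤ.^ i *ᶻ + choose ℓ i
  P Q R W : ℕ → ℤ
  P i = sign i *ᶻ g (ℓ ∸ i)
  Q i = -1ℤ ℤ.^ suc i *ᶻ + choose ℓ (suc i) *ᶻ g (ℓ ∸ i)
  R i = sign i *ᶻ g (suc (ℓ ∸ i))
  W i = sign i *ᶻ g (suc ℓ ∸ i)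
  split : ∀ s x y z → (-1ℤ *ᶻ s) *ᶻ (x +ᶻ y) *ᶻ z ≡ (-1ℤ *ᶻ s) *ᶻ y *ᶻ z -ᶻ s *ᶻ x *ᶻ z
  split = solve-∀
  pascal : ∀ i → -1ℤ ℤ.^ suc i *ᶻ + choose (suc ℓ) (suc i) *ᶻ g (ℓ ∸ i) ≡ Q i -ᶻ P i
  pascal i = trans (cong (λ x → -1ℤ ℤ.^ suc i *ᶻ x *ᶻ g (ℓ ∸ i)) (ℤ.pos-+ (choose ℓ i) _))
                   (split (-1ℤ ℤ.^ i) _ _ _)
  W-first : 1ℤ *ᶻ 1ℤ *ᶻ g (suc ℓ) ≡ W 0
  W-first = cong (λ x → 1ℤ *ᶻ + x *ᶻ g (suc ℓ)) (sym (choose-zeroʳ ℓ))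
  W-last : W (suc ℓ) ≡ 0ℤ
  W-last = begin
    -1ℤ ℤ.^ suc ℓ *ᶻ + choose ℓ (suc ℓ) *ᶻ g (ℓ ∸ ℓ)
      ≡⟨ cong (λ x → -1ℤ ℤ.^ suc ℓ *ᶻ + x *ᶻ g (ℓ ∸ ℓ)) (choose-< (ℕ.n<1+n ℓ)) ⟩
    -1ℤ ℤ.^ suc ℓ *ᶻ 0ℤ *ᶻ g (ℓ ∸ ℓ)
      ≡⟨ cong (_*ᶻ g (ℓ ∸ ℓ)) (ℤ.*-zeroʳ (-1ℤ ℤ.^ suc ℓ)) ⟩
    0ℤ *ᶻ g (ℓ ∸ ℓ)
      ≡⟨ ℤ.*-zeroˡ (g (ℓ ∸ ℓ)) ⟩
    0ℤ
      ∎
  W≡R : ∀ i → i < suc ℓ → W i ≡ R i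
  W≡R i i<1+ℓ = cong (λ m → sign i *ᶻ g m) (ℕ.+-∸-assoc 1 (ℕ.≤-pred i<1+ℓ))

Δ^≡alternatingSum : ∀ ℓ g → Δ^ ℓ g 0 ≡ alternatingSum ℓ g
Δ^≡alternatingSum zero    g = unit (g 0)
  where
  unit : ∀ x → x ≡ 1ℤ *ᶻ 1ℤ *ᶻ x +ᶻ 0ℤ
  unit = solve-∀
Δ^≡alternatingSum (suc ℓ) g = trans (Δ^≡alternatingSum ℓ (Δ g)) (sym (alternatingSum-suc ℓ g))

fromℚᵘ-homo-+ : ∀ p q → fromℚᵘ p ℚ.+ fromℚᵘ q ≡ fromℚᵘ (p ℚᵘ.+ q)
fromℚᵘ-homo-+ p q = ℚ.toℚᵘ-injective (begin
  ℚ.toℚᵘ (fromℚᵘ p ℚ.+ fromℚᵘ q)               ≈⟨ ℚ.toℚᵘ-homo-+ (fromℚᵘ p) (fromℚᵘ q) ⟩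
  ℚ.toℚᵘ (fromℚᵘ p) ℚᵘ.+ ℚ.toℚᵘ (fromℚᵘ q)     ≈⟨ ℚᵘ.+-cong (ℚ.toℚᵘ-fromℚᵘ p) (ℚ.toℚᵘ-fromℚᵘ q) ⟩
  p ℚᵘ.+ q                                      ≈⟨ ℚ.toℚᵘ-fromℚᵘ (p ℚᵘ.+ q) ⟨
  ℚ.toℚᵘ (fromℚᵘ (p ℚᵘ.+ q))                    ∎)
  where open ℚᵘ.≃-Reasoning

fromℚᵘ-homo-* : ∀ p q → fromℚᵘ p ℚ.* fromℚᵘ q ≡ fromℚᵘ (p ℚᵘ.* q)
fromℚᵘ-homo-* p q = ℚ.toℚᵘ-injective (begin
  ℚ.toℚᵘ (fromℚᵘ p ℚ.* fromℚᵘ q)               ≈⟨ ℚ.toℚᵘ-homo-* (fromℚᵘ p) (fromℚᵘ q) ⟩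
  ℚ.toℚᵘ (fromℚᵘ p) ℚᵘ.* ℚ.toℚᵘ (fromℚᵘ q)     ≈⟨ ℚᵘ.*-cong (ℚ.toℚᵘ-fromℚᵘ p) (ℚ.toℚᵘ-fromℚᵘ q) ⟩
  p ℚᵘ.* q                                      ≈⟨ ℚ.toℚᵘ-fromℚᵘ (p ℚᵘ.* q) ⟨
  ℚ.toℚᵘ (fromℚᵘ (p ℚᵘ.* q))                    ∎)
  where open ℚᵘ.≃-Reasoning

/1-homo-+ : ∀ x y → (x / 1) ℚ.+ (y / 1) ≡ (x +ᶻ y) / 1
/1-homo-+ x y = trans (fromℚᵘ-homo-+ (mkℚᵘ x 0) (mkℚᵘ y 0))
  (ℚ.fromℚᵘ-cong {mkℚᵘ x 0 ℚᵘ.+ mkℚᵘ y 0} {mkℚᵘ (x +ᶻ y) 0} (*≡* (unit x y)))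
  where
  unit : ∀ x y → (x *ᶻ 1ℤ +ᶻ y *ᶻ 1ℤ) *ᶻ 1ℤ ≡ (x +ᶻ y) *ᶻ (1ℤ *ᶻ 1ℤ)
  unit = solve-∀

/1-homo-* : ∀ x y → (x / 1) ℚ.* (y / 1) ≡ (x *ᶻ y) / 1
/1-homo-* x y = trans (fromℚᵘ-homo-* (mkℚᵘ x 0) (mkℚᵘ y 0))
  (ℚ.fromℚᵘ-cong {mkℚᵘ x 0 ℚᵘ.* mkℚᵘ y 0} {mkℚᵘ (x *ᶻ y) 0} (*≡* (unit x y)))
  where
  unit : ∀ x y → (x *ᶻ y) *ᶻ 1ℤ ≡ (x *ᶻ y) *ᶻ (1ℤ *ᶻ 1ℤ)
  unit = solve-∀

/-*-cancel : ∀ a l x → (+ a / suc l) ℚ.* ((x *ᶻ + suc l) / 1) ≡ (+ a *ᶻ x) / 1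
/-*-cancel a l x = trans (fromℚᵘ-homo-* (mkℚᵘ (+ a) l) (mkℚᵘ (x *ᶻ + suc l) 0))
  (ℚ.fromℚᵘ-cong {mkℚᵘ (+ a) l ℚᵘ.* mkℚᵘ (x *ᶻ + suc l) 0} {mkℚᵘ (+ a *ᶻ x) 0}
                 (*≡* (cancel (+ a) x (+ suc l))))
  where
  cancel : ∀ a x n → (a *ᶻ (x *ᶻ n)) *ᶻ 1ℤ ≡ (a *ᶻ x) *ᶻ (n *ᶻ 1ℤ)
  cancel = solve-∀

foldr-applyUpTo-/1 : ∀ n (f : ℕ → ℕ) (g : ℕ → ℚ) (h : ℕ → ℤ) → (∀ i → i < n → g (f i) ≡ h i / 1) →
                     List.foldr ℚ._+_ ℚ.0ℚ (List.map g (List.applyUpTo f n)) ≡ ∑ n h / 1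
foldr-applyUpTo-/1 zero    f g h eq = refl
foldr-applyUpTo-/1 (suc n) f g h eq =
  trans (cong₂ ℚ._+_ (eq 0 (s≤s z≤n))
                     (foldr-applyUpTo-/1 n (f ∘ suc) g (h ∘ suc) (λ i i<n → eq (suc i) (s≤s i<n))))
        (/1-homo-+ (h 0) (∑ n (h ∘ suc)))

-- The sequences C(kj, k) and C(kj + K, K), where k = K + 1

*-suc-pred : ∀ K j → suc K * suc j ≡ suc (suc K * j + K)
*-suc-pred = ℕ-Solver.solve-∀

module Sequences (K : ℕ) where

  private
    k : ℕ
    k = suc K

  c e : ℕ → ℤ
  c j = + choose (k * j) k
  e j = + choose (k * j + K) K

  ê : ℕ → ℤ
  ê s = Δ^ s e 0

  c-zero : c 0 ≡ 0ℤ
  c-zero = cong (λ m → + choose m k) (ℕ.*-zeroʳ k)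

  c-pascal : ∀ j → c (suc j) ≡ e j +ᶻ + choose (k * j + K) k
  c-pascal j = trans (cong (λ m → + choose m k) (*-suc-pred K j)) (ℤ.pos-+ (choose (k * j + K) K) _)

  c-absorb : ∀ j → c (suc j) ≡ + suc j *ᶻ e j
  c-absorb j = trans (cong +_ (ℕ.*-cancelˡ-≡ _ _ k (begin
    k * choose (k * suc j) k                ≡⟨ cong (λ m → k * choose m k) (*-suc-pred K j) ⟩
    k * choose (suc (k * j + K)) k          ≡⟨ choose-absorb (k * j + K) K ⟩
    suc (k * j + K) * choose (k * j + K) K  ≡⟨ cong (_* choose (k * j + K) K) (*-suc-pred K j) ⟨
    k * suc j * choose (k * j + K) K        ≡⟨ ℕ.*-assoc k (suc j) _ ⟩
    k * (suc j * choose (k * j + K) K)      ∎))) (ℤ.pos-* (suc j) _)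
    where open ≡-Reasoning

  e-newton : ∀ j → e j ≡ ∑ k (λ s → + choose j s *ᶻ ê s)
  e-newton = newton k e (Degree<-choose k K K)

  c-newton : ∀ j → c j ≡ ∑ k (λ s → (+ suc s *ᶻ ê s) *ᶻ + choose j (suc s))
  c-newton zero    = trans c-zero (sym (∑-zero k (λ s → ℤ.*-zeroʳ (+ suc s *ᶻ ê s))))
  c-newton (suc j) = begin
    c (suc j)                                   ≡⟨ c-absorb j ⟩
    + suc j *ᶻ e j                              ≡⟨ cong (+ suc j *ᶻ_) (e-newton j) ⟩
    + suc j *ᶻ ∑ k (λ s → + choose j s *ᶻ ê s)
      ≡⟨ *-distribˡ-∑ k (+ suc j) (λ s → + choose j s *ᶻ ê s) ⟩
    ∑ k (λ s → + suc j *ᶻ (+ choose j s *ᶻ ê s))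
      ≡⟨ ∑-cong k absorb ⟩
    ∑ k (λ s → (+ suc s *ᶻ ê s) *ᶻ + choose (suc j) (suc s))
      ∎
    where
    open ≡-Reasoning
    reorder : ∀ x y z w v → x *ᶻ y ≡ z *ᶻ w → x *ᶻ (y *ᶻ v) ≡ (z *ᶻ v) *ᶻ w
    reorder x y z w v eq = trans (sym (ℤ.*-assoc x y v)) (trans (cong (_*ᶻ v) eq) (swap z w v))
      where
      swap : ∀ z w v → z *ᶻ w *ᶻ v ≡ z *ᶻ v *ᶻ w
      swap = solve-∀
    absorb : ∀ s → + suc j *ᶻ (+ choose j s *ᶻ ê s) ≡ (+ suc s *ᶻ ê s) *ᶻ + choose (suc j) (suc s)
    absorb s = reorder (+ suc j) (+ choose j s) (+ suc s) (+ choose (suc j) (suc s)) (ê s)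
      (trans (sym (ℤ.pos-* (suc j) (choose j s)))
        (trans (cong +_ (sym (choose-absorb j s))) (ℤ.pos-* (suc s) (choose (suc j) (suc s)))))

  Δ-c : ∀ j → Δ c j ≡ ∑ k (λ s → (+ suc s *ᶻ ê s) *ᶻ + choose j s)
  Δ-c j = trans (cong₂ _-ᶻ_ (c-newton (suc j)) (c-newton j))
                (Δ-∑-choose k (λ s → + suc s *ᶻ ê s) j)

  Δ^-c : ∀ s → s < k → Δ^ (suc s) c 0 ≡ + suc s *ᶻ ê s
  Δ^-c s s<k = begin
    Δ^ (suc s) c 0
      ≡⟨ Δ^-cong (suc s) c-newton 0 ⟩
    Δ^ (suc s) (λ j → ∑ k (λ t → a t *ᶻ + choose j (suc t))) 0
      ≡⟨ Δ^-∑ (suc s) k (λ t j → a t *ᶻ + choose j (suc t)) 0 ⟩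
    ∑ k (λ t → Δ^ (suc s) (λ j → a t *ᶻ + choose j (suc t)) 0)
      ≡⟨ ∑-cong k (λ t → trans (Δ^-* (suc s) (a t) (λ j → + choose j (suc t)) 0)
                               (cong (a t *ᶻ_) (Δ^-choose (suc s) (suc t)))) ⟩
    ∑ k (λ t → a t *ᶻ δ s t)
      ≡⟨ ∑-δ a s<k ⟩
    + suc s *ᶻ ê s
      ∎
    where
    open ≡-Reasoning
    a : ℕ → ℤ
    a t = + suc t *ᶻ ê t

  innerSum≡Δ^c : ∀ ℓ → innerSum k ℓ ≡ Δ^ ℓ c 0
  innerSum≡Δ^c ℓ = begin
    innerSum k ℓ
      ≡⟨ foldr-applyUpTo ℓ (λ i → i) (λ i → -1ℤ ℤ.^ i *ᶻ + (ℓ C i) *ᶻ + ((k * (ℓ ∸ i)) C k)) ⟩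
    ∑ ℓ (λ i → -1ℤ ℤ.^ i *ᶻ + (ℓ C i) *ᶻ + ((k * (ℓ ∸ i)) C k))
      ≡⟨ ∑-cong ℓ (λ i → cong₂ (λ x y → -1ℤ ℤ.^ i *ᶻ + x *ᶻ + y)
                               (C≡choose ℓ i) (C≡choose (k * (ℓ ∸ i)) k)) ⟩
    ∑ ℓ term
      ≡⟨ ℤ.+-identityʳ (∑ ℓ term) ⟨
    ∑ ℓ term +ᶻ 0ℤ
      ≡⟨ cong (∑ ℓ term +ᶻ_) last-term ⟨
    ∑ ℓ term +ᶻ term ℓ
      ≡⟨ ∑-last ℓ term ⟨
    alternatingSum ℓ c
      ≡⟨ Δ^≡alternatingSum ℓ c ⟨
    Δ^ ℓ c 0
      ∎
    where
    open ≡-Reasoning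
    term : ℕ → ℤ
    term i = -1ℤ ℤ.^ i *ᶻ + choose ℓ i *ᶻ c (ℓ ∸ i)
    last-term : term ℓ ≡ 0ℤ
    last-term = begin
      -1ℤ ℤ.^ ℓ *ᶻ + choose ℓ ℓ *ᶻ c (ℓ ∸ ℓ)
        ≡⟨ cong (λ m → -1ℤ ℤ.^ ℓ *ᶻ + choose ℓ ℓ *ᶻ c m) (ℕ.n∸n≡0 ℓ) ⟩
      -1ℤ ℤ.^ ℓ *ᶻ + choose ℓ ℓ *ᶻ c 0
        ≡⟨ cong (-1ℤ ℤ.^ ℓ *ᶻ + choose ℓ ℓ *ᶻ_) c-zero ⟩
      -1ℤ ℤ.^ ℓ *ᶻ + choose ℓ ℓ *ᶻ 0ℤ
        ≡⟨ ℤ.*-zeroʳ (-1ℤ ℤ.^ ℓ *ᶻ + choose ℓ ℓ) ⟩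
      0ℤ
        ∎

  closedForm : ℕ → ℤ
  closedForm m = + m +ᶻ ∑ k (λ s → (+ s *ᶻ ê s) *ᶻ + choose m (suc s))

  choose-new : ∀ j → + choose (k * j + K) k ≡ c j +ᶻ ∑ k (λ s → (+ s *ᶻ ê s) *ᶻ + choose j s)
  choose-new j = begin
    + choose (k * j + K) k
      ≡⟨ isolate (c j) (e j) (+ choose (k * j + K) k) ⟩
    c j +ᶻ ((e j +ᶻ + choose (k * j + K) k -ᶻ c j) -ᶻ e j)
      ≡⟨ cong (λ x → c j +ᶻ ((x -ᶻ c j) -ᶻ e j)) (c-pascal j) ⟨
    c j +ᶻ (Δ c j -ᶻ e j)
      ≡⟨ cong (c j +ᶻ_) (cong₂ _-ᶻ_ (Δ-c j) (e-newton j)) ⟩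
    c j +ᶻ (∑ k (λ s → (+ suc s *ᶻ ê s) *ᶻ + choose j s) -ᶻ ∑ k (λ s → + choose j s *ᶻ ê s))
      ≡⟨ cong (c j +ᶻ_) (∑-distrib-- k (λ s → (+ suc s *ᶻ ê s) *ᶻ + choose j s)
                                       (λ s → + choose j s *ᶻ ê s)) ⟨
    c j +ᶻ ∑ k (λ s → (+ suc s *ᶻ ê s) *ᶻ + choose j s -ᶻ + choose j s *ᶻ ê s)
      ≡⟨ cong (c j +ᶻ_) (∑-cong k (λ s → cancel (+ s) (ê s) (+ choose j s))) ⟩
    c j +ᶻ ∑ k (λ s → (+ s *ᶻ ê s) *ᶻ + choose j s)
      ∎
    where
    open ≡-Reasoning
    isolate : ∀ x y z → z ≡ x +ᶻ ((y +ᶻ z -ᶻ x) -ᶻ y)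
    isolate = solve-∀
    cancel : ∀ s x y → ((1ℤ +ᶻ s) *ᶻ x) *ᶻ y -ᶻ y *ᶻ x ≡ (s *ᶻ x) *ᶻ y
    cancel = solve-∀

  closedForm-suc : ∀ j →
                   closedForm (suc j) +ᶻ c j ≡ closedForm j +ᶻ + suc (choose (k * j + K) k)
  closedForm-suc j = begin
    (1ℤ +ᶻ + j +ᶻ R (suc j)) +ᶻ c j
      ≡⟨ cong (λ x → (1ℤ +ᶻ + j +ᶻ x) +ᶻ c j) R-suc ⟩
    (1ℤ +ᶻ + j +ᶻ (R j +ᶻ S)) +ᶻ c j
      ≡⟨ reorder (+ j) (R j) S (c j) ⟩
    (+ j +ᶻ R j) +ᶻ (1ℤ +ᶻ (c j +ᶻ S))
      ≡⟨ cong (λ x → (+ j +ᶻ R j) +ᶻ (1ℤ +ᶻ x)) (choose-new j) ⟨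
    closedForm j +ᶻ + suc (choose (k * j + K) k)
      ∎
    where
    open ≡-Reasoning
    R : ℕ → ℤ
    R m = ∑ k (λ s → (+ s *ᶻ ê s) *ᶻ + choose m (suc s))
    S : ℤ
    S = ∑ k (λ s → (+ s *ᶻ ê s) *ᶻ + choose j s)
    shift : ∀ x y → x ≡ y +ᶻ (x -ᶻ y)
    shift = solve-∀
    R-suc : R (suc j) ≡ R j +ᶻ S
    R-suc = trans (shift (R (suc j)) (R j)) (cong (R j +ᶻ_) (Δ-∑-choose k (λ s → + s *ᶻ ê s) j))
    reorder : ∀ j r s x → (1ℤ +ᶻ j +ᶻ (r +ᶻ s)) +ᶻ x ≡ (j +ᶻ r) +ᶻ (1ℤ +ᶻ (x +ᶻ s))
    reorder = solve-∀

  f≡closedForm : ∀ m → f k m ≡ closedForm m / 1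
  f≡closedForm m = begin
    f k m
      ≡⟨ cong (+ m / 1 ℚ.+_) (foldr-applyUpTo-/1 K (λ i → i) _ h b-term) ⟩
    + m / 1 ℚ.+ ∑ K h / 1
      ≡⟨ /1-homo-+ (+ m) (∑ K h) ⟩
    (+ m +ᶻ ∑ K h) / 1
      ≡⟨ cong (λ x → (+ m +ᶻ x) / 1) (ℤ.+-identityˡ (∑ K h)) ⟨
    (+ m +ᶻ (0ℤ +ᶻ ∑ K h)) / 1
      ≡⟨ cong (λ x → (+ m +ᶻ (x +ᶻ ∑ K h)) / 1) (ℤ.*-zeroˡ (+ choose m 1)) ⟨
    closedForm m / 1
      ∎
    where
    open ≡-Reasoning
    h : ℕ → ℤ
    h x = (+ suc x *ᶻ ê (suc x)) *ᶻ + choose m (2 + x)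
    b-term : ∀ x → x < K → b k (2 + x) ℚ.* (+ (m C (2 + x)) / 1) ≡ h x / 1
    b-term x x<K = begin
      (+ suc x / (2 + x)) ℚ.* (innerSum k (2 + x) / 1) ℚ.* (+ (m C (2 + x)) / 1)
        ≡⟨ cong₂ (λ y z → (+ suc x / (2 + x)) ℚ.* (y / 1) ℚ.* (+ z / 1))
                 (trans (innerSum≡Δ^c (2 + x)) (Δ^-c (suc x) (s≤s x<K))) (C≡choose m (2 + x)) ⟩
      (+ suc x / (2 + x)) ℚ.* ((+ (2 + x) *ᶻ ê (suc x)) / 1) ℚ.* (+ choose m (2 + x) / 1)
        ≡⟨ cong (λ y → (+ suc x / (2 + x)) ℚ.* (y / 1) ℚ.* (+ choose m (2 + x) / 1))
                (ℤ.*-comm (+ (2 + x)) (ê (suc x))) ⟩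
      (+ suc x / (2 + x)) ℚ.* ((ê (suc x) *ᶻ + (2 + x)) / 1) ℚ.* (+ choose m (2 + x) / 1)
        ≡⟨ cong (ℚ._* (+ choose m (2 + x) / 1)) (/-*-cancel (suc x) (suc x) (ê (suc x))) ⟩
      ((+ suc x *ᶻ ê (suc x)) / 1) ℚ.* (+ choose m (2 + x) / 1)
        ≡⟨ /1-homo-* (+ suc x *ᶻ ê (suc x)) (+ choose m (2 + x)) ⟩
      h x / 1
        ∎

-- Counting subsets of Fin n

T-not⁺ : ∀ {x} → ¬ T x → T (not x)
T-not⁺ {false} _   = _
T-not⁺ {true}  ¬tt = ¬tt _

T-not⁻ : ∀ {x} → T (not x) → ¬ T x
T-not⁻ {false} _ ()

T-injective : ∀ {x y} → (T x → T y) → (T y → T x) → x ≡ y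
T-injective {false} {false} _ _ = refl
T-injective {false} {true}  _ f = ⊥-elim (f _)
T-injective {true}  {false} f _ = ⊥-elim (f _)
T-injective {true}  {true}  _ _ = refl

count : (n : ℕ) → (Subset n → Bool) → ℕ
count zero    P = if P [] then 1 else 0
count (suc n) P = count n (λ E → P (outside ∷ E)) + count n (λ E → P (inside ∷ E))

length-filter-map : ∀ {A B : Set} (P : B → Bool) (g : A → B) (xs : List A) →
  length (filter (λ y → P y ≟𝔹 true) (List.map g xs)) ≡ length (filter (λ x → P (g x) ≟𝔹 true) xs)
length-filter-map P g []       = refl
length-filter-map P g (x ∷ xs) with P (g x)
... | true  = cong suc (length-filter-map P g xs)
... | false = length-filter-map P g xs

length-filter-allSubsets : ∀ n (P : Subset n → Bool) →
                           length (filter (λ E → P E ≟𝔹 true) (allSubsets n)) ≡ count n P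
length-filter-allSubsets zero    P with P []
... | true  = refl
... | false = refl
length-filter-allSubsets (suc n) P = begin
  length (filter P? (outs List.++ ins))
    ≡⟨ cong length (List.filter-++ P? outs ins) ⟩
  length (filter P? outs List.++ filter P? ins)
    ≡⟨ List.length-++ (filter P? outs) ⟩
  length (filter P? outs) + length (filter P? ins)
    ≡⟨ cong₂ _+_ (trans (length-filter-map P (outside ∷_) (allSubsets n)) (length-filter-allSubsets n _))
                 (trans (length-filter-map P (inside ∷_) (allSubsets n)) (length-filter-allSubsets n _)) ⟩
  count (suc n) P
    ∎
  where
  open ≡-Reasoning
  P? = λ E → P E ≟𝔹 true
  outs ins : List (Subset (suc n))
  outs = List.map (outside ∷_) (allSubsets n)
  ins  = List.map (inside ∷_) (allSubsets n)

count-cong : ∀ n {P Q : Subset n → Bool} → (∀ E → P E ≡ Q E) → count n P ≡ count n Q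
count-cong zero    eq = cong (if_then 1 else 0) (eq [])
count-cong (suc n) eq = cong₂ _+_ (count-cong n (eq ∘ (outside ∷_))) (count-cong n (eq ∘ (inside ∷_)))

count-false : ∀ n → count n (λ _ → false) ≡ 0
count-false zero    = refl
count-false (suc n) = cong₂ _+_ (count-false n) (count-false n)

count-∨ : ∀ n (P Q : Subset n → Bool) → (∀ E → T (P E) → ¬ T (Q E)) →
          count n (λ E → P E ∨ Q E) ≡ count n P + count n Q
count-∨ zero P Q disjoint with P [] | Q [] | disjoint []
... | true  | true  | never = ⊥-elim (never _ _)
... | true  | false | _     = refl
... | false | _     | _     = refl
count-∨ (suc n) P Q disjoint = begin
  count n (λ E → P (outside ∷ E) ∨ Q (outside ∷ E)) + count n (λ E → P (inside ∷ E) ∨ Q (inside ∷ E))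
    ≡⟨ cong₂ _+_ (count-∨ n _ _ (disjoint ∘ (outside ∷_))) (count-∨ n _ _ (disjoint ∘ (inside ∷_))) ⟩
  (count n (P ∘ (outside ∷_)) + count n (Q ∘ (outside ∷_)))
    + (count n (P ∘ (inside ∷_)) + count n (Q ∘ (inside ∷_)))
    ≡⟨ +-interchange (count n (P ∘ (outside ∷_))) _ _ _ ⟩
  count (suc n) P + count (suc n) Q
    ∎
  where open ≡-Reasoning

-- Recursion on subsets goes through `does`, which computes on cons cells where ⌊_⌋ is stuck.
count-≡ : ∀ {n} (X : Subset n) → count n (λ E → ⌊ ≡-dec _≟𝔹_ E X ⌋) ≡ 1
count-≡ {n} X = trans (count-cong n (λ E → isYes≗does (≡-dec _≟𝔹_ E X))) (count-does X)
  where
  count-does : ∀ {n} (X : Subset n) → count n (λ E → does (≡-dec _≟𝔹_ E X)) ≡ 1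
  count-does         []          = refl
  count-does {suc n} (false ∷ X) = cong₂ _+_ (count-does X) (count-false n)
  count-does {suc n} (true  ∷ X) = cong₂ _+_ (count-false n) (count-does X)

inBinomOf : ∀ {n} → Subset n → ℕ → Subset n → Bool
inBinomOf A r E = ⌊ E ⊆? A ⌋ ∧ (∣ E ∣ ≡ᵇ r)

count-inBinomOf : ∀ {n} (A : Subset n) r → count n (inBinomOf A r) ≡ choose ∣ A ∣ r
count-inBinomOf {n} A r =
  trans (count-cong n (λ E → cong (_∧ (∣ E ∣ ≡ᵇ r)) (isYes≗does (E ⊆? A)))) (count-does A r)
  where
  count-does : ∀ {n} (A : Subset n) r → count n (λ E → does (E ⊆? A) ∧ (∣ E ∣ ≡ᵇ r)) ≡ choose ∣ A ∣ r
  count-does         []          zero    = refl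
  count-does         []          (suc r) = refl
  count-does {suc n} (false ∷ A) r       =
    trans (cong₂ _+_ (count-does A r) (count-false n)) (ℕ.+-identityʳ _)
  count-does {suc n} (true  ∷ A) zero    = begin
    count n (λ E → does (E ⊆? A) ∧ (∣ E ∣ ≡ᵇ 0)) + count n (λ E → does (E ⊆? A) ∧ false)
      ≡⟨ cong₂ _+_ (count-does A zero) (trans (count-cong n (λ E → Bool.∧-zeroʳ (does (E ⊆? A))))
                                                (count-false n)) ⟩
    choose (∣ A ∣) 0 + 0
      ≡⟨ ℕ.+-identityʳ _ ⟩
    choose (∣ A ∣) 0
      ≡⟨ trans (choose-zeroʳ (∣ A ∣)) (sym (choose-zeroʳ (suc (∣ A ∣)))) ⟩
    choose (suc (∣ A ∣)) 0
      ∎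
    where open ≡-Reasoning
  count-does {suc n} (true  ∷ A) (suc r) =
    trans (cong₂ _+_ (count-does A (suc r)) (count-does A r)) (ℕ.+-comm (choose ∣ A ∣ (suc r)) _)

count-inBinomOf-diff : ∀ {n} {A B : Subset n} r → A ⊆ B →
  count n (λ E → inBinomOf B r E ∧ not (inBinomOf A r E)) + choose (∣ A ∣) r ≡ choose (∣ B ∣) r
count-inBinomOf-diff {n} {A} {B} r A⊆B = begin
  count n diff + choose (∣ A ∣) r
    ≡⟨ cong (λ x → count n diff + x) (count-inBinomOf A r) ⟨
  count n diff + count n (inBinomOf A r)
    ≡⟨ count-∨ n diff (inBinomOf A r) (λ E → T-not⁻ ∘ proj₂ ∘ Equivalence.to Bool.T-∧) ⟨
  count n (λ E → diff E ∨ inBinomOf A r E)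
    ≡⟨ count-cong n (λ E → split (inA⇒inB E)) ⟩
  count n (inBinomOf B r)
    ≡⟨ count-inBinomOf B r ⟩
  choose (∣ B ∣) r
    ∎
  where
  open ≡-Reasoning
  diff : Subset n → Bool
  diff E = inBinomOf B r E ∧ not (inBinomOf A r E)
  inA⇒inB : ∀ E → T (inBinomOf A r E) → T (inBinomOf B r E)
  inA⇒inB E h with Equivalence.to Bool.T-∧ h
  ... | E⊆A , size =
    Equivalence.from Bool.T-∧
      (fromWitness {a? = E ⊆? B} (⊆-trans (toWitness {a? = E ⊆? A} E⊆A) A⊆B) , size)
  split : ∀ {x y} → (T y → T x) → (x ∧ not y) ∨ y ≡ x
  split {true}  {true}  _ = refl
  split {true}  {false} _ = refl
  split {false} {true}  f = ⊥-elim (f _)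
  split {false} {false} _ = refl

∈-tabulate⁻ : ∀ {n} {p : Fin n → Bool} {i} → i ∈ tabulate p → T (p i)
∈-tabulate⁻ {p = p} {i} i∈p =
  Equivalence.from Bool.T-≡ (trans (sym (lookup∘tabulate p i)) ([]=⇒lookup i∈p))

∈-tabulate⁺ : ∀ {n} {p : Fin n → Bool} {i} → T (p i) → i ∈ tabulate p
∈-tabulate⁺ {p = p} {i} pi =
  lookup⇒[]= i (tabulate p) (trans (lookup∘tabulate p i) (Equivalence.to Bool.T-≡ pi))

-- Vset k j and Mset k j are, by definition, below (k * j) and interval (k * j) (k * suc j).
below : ∀ {n} → ℕ → Subset n
below t = tabulate (λ i → toℕ i <ᵇ t)

interval : ∀ {n} → ℕ → ℕ → Subset n
interval a b = tabulate (λ i → (a ≤ᵇ toℕ i) ∧ (toℕ i <ᵇ b))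

∈-below⁻ : ∀ {n t} {i : Fin n} → i ∈ below t → toℕ i < t
∈-below⁻ {t = t} {i} i∈ = ℕ.<ᵇ⇒< (toℕ i) t (∈-tabulate⁻ i∈)

∈-below⁺ : ∀ {n t} {i : Fin n} → toℕ i < t → i ∈ below t
∈-below⁺ i<t = ∈-tabulate⁺ (ℕ.<⇒<ᵇ i<t)

∈-interval⁻ : ∀ {n a b} {i : Fin n} → i ∈ interval a b → a ≤ toℕ i × toℕ i < b
∈-interval⁻ {a = a} {b} {i} i∈ with Equivalence.to Bool.T-∧ (∈-tabulate⁻ i∈)
... | a≤i , i<b = ℕ.≤ᵇ⇒≤ a (toℕ i) a≤i , ℕ.<ᵇ⇒< (toℕ i) b i<b

∈-interval⁺ : ∀ {n a b} {i : Fin n} → a ≤ toℕ i → toℕ i < b → i ∈ interval a b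
∈-interval⁺ a≤i i<b = ∈-tabulate⁺ (Equivalence.from Bool.T-∧ (ℕ.≤⇒≤ᵇ a≤i , ℕ.<⇒<ᵇ i<b))

below-mono : ∀ {n t u} → t ≤ u → below {n} t ⊆ below u
below-mono t≤u i∈ = ∈-below⁺ (ℕ.<-≤-trans (∈-below⁻ i∈) t≤u)

interval⊆below : ∀ {n a b} → interval {n} a b ⊆ below b
interval⊆below {a = a} {b} i∈ = ∈-below⁺ (proj₂ (∈-interval⁻ {a = a} {b} i∈))

∣below∣ : ∀ {n t} → t ≤ n → ∣ below {n} t ∣ ≡ t
∣below∣ {n}     {zero}  _         = ∣below-zero∣ n
  where
  ∣below-zero∣ : ∀ n → ∣ below {n} 0 ∣ ≡ 0
  ∣below-zero∣ zero    = refl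
  ∣below-zero∣ (suc n) = ∣below-zero∣ n
∣below∣ {suc n} {suc t} (s≤s t≤n) = cong suc (∣below∣ t≤n)

vertexIn⁻ : ∀ {n} t (E : Subset n) → T (vertexIn (suc t) E) → ∃ λ i → i ∈ E × toℕ i ≡ t
vertexIn⁻ {n} t E v with satisfied (any⁻ _ (List.allFin n) v)
... | i , pi with Equivalence.to Bool.T-∧ pi
...   | i∈E , i≡t = i , lookup⇒[]= i E (Equivalence.to Bool.T-≡ i∈E) , ℕ.≡ᵇ⇒≡ (toℕ i) t i≡t

vertexIn⁺ : ∀ {n} t (E : Subset n) {i} → i ∈ E → toℕ i ≡ t → T (vertexIn (suc t) E)
vertexIn⁺ {n} t E {i} i∈E i≡t = any⁺ _ (lose (∈-allFin i)
  (Equivalence.from Bool.T-∧ (Equivalence.from Bool.T-≡ ([]=⇒lookup i∈E) , ℕ.≡⇒≡ᵇ (toℕ i) t i≡t)))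

⊆?-below-suc : ∀ {n} t (E : Subset n) →
               ⌊ E ⊆? below t ⌋ ≡ ⌊ E ⊆? below (suc t) ⌋ ∧ not (vertexIn (suc t) E)
⊆?-below-suc t E = T-injective to from
  where
  to : T ⌊ E ⊆? below t ⌋ → T (⌊ E ⊆? below (suc t) ⌋ ∧ not (vertexIn (suc t) E))
  to h = Equivalence.from Bool.T-∧
    (fromWitness (λ {i} i∈E → below-mono (ℕ.n≤1+n t) (E⊆ i∈E)) , T-not⁺ t∉E)
    where
    E⊆ : E ⊆ below t
    E⊆ = toWitness h
    t∉E : ¬ T (vertexIn (suc t) E)
    t∉E v with vertexIn⁻ t E v
    ... | i , i∈E , i≡t = ℕ.<-irrefl i≡t (∈-below⁻ (E⊆ i∈E))
  from : T (⌊ E ⊆? below (suc t) ⌋ ∧ not (vertexIn (suc t) E)) → T ⌊ E ⊆? below t ⌋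
  from h with Equivalence.to Bool.T-∧ h
  ... | E⊆ , t∉E = fromWitness (λ {i} i∈E →
    ∈-below⁺ (ℕ.≤∧≢⇒< (ℕ.≤-pred (∈-below⁻ (toWitness E⊆ i∈E))) (T-not⁻ t∉E ∘ vertexIn⁺ t E i∈E)))

nonempty?-interval : ∀ {n} a b (E : Subset n) → E ⊆ below b →
                     ⌊ nonempty? (E ∩ interval a b) ⌋ ≡ not ⌊ E ⊆? below a ⌋
nonempty?-interval {n} a b E E⊆b = T-injective to from
  where
  to : T ⌊ nonempty? (E ∩ interval a b) ⌋ → T (not ⌊ E ⊆? below a ⌋)
  to h with toWitness h
  ... | i , i∈E∩I = T-not⁺ (λ E⊆a → ℕ.<⇒≱ (∈-below⁻ (toWitness E⊆a (proj₁ i∈)))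
                                          (proj₁ (∈-interval⁻ {a = a} {b} (proj₂ i∈))))
    where
    i∈ = x∈p∩q⁻ E (interval a b) i∈E∩I
  from : T (not ⌊ E ⊆? below a ⌋) → T ⌊ nonempty? (E ∩ interval a b) ⌋
  from h with nonempty? (E ∩ interval a b)
  ... | yes _     = _
  ... | no  empty = T-not⁻ h (fromWitness {a? = E ⊆? below a} E⊆a)
    where
    E⊆a : E ⊆ below a
    E⊆a {i} i∈E with toℕ i ℕ.<? a
    ... | yes i<a = ∈-below⁺ i<a
    ... | no  i≮a =
      ⊥-elim (empty (i , x∈p∩q⁺ (i∈E , ∈-interval⁺ (ℕ.≮⇒≥ i≮a) (∈-below⁻ {t = b} (E⊆b i∈E)))))


-- The hypergraphs H*_j, where k = K + 1

module Hypergraph (K : ℕ) where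

  private
    k : ℕ
    k = suc K

  isNewEdge isMset : ∀ {n} → ℕ → Subset n → Bool
  isNewEdge j E = inBinom k (suc j) E ∧ ⌊ nonempty? (E ∩ Mset k j) ⌋ ∧ not (vertexIn (k * suc j) E)
  isMset    j E = ⌊ ≡-dec _≟𝔹_ E (Mset k j) ⌋

  edge⊆V : ∀ {n} j (E : Subset n) → T (isEdge k j E) → E ⊆ Vset k j
  edge⊆V (suc j) E h with Equivalence.to (Bool.T-∨ {isEdge k j E}) h
  ... | inj₁ old = λ i∈E → below-mono (ℕ.*-monoʳ-≤ k (ℕ.n≤1+n j)) (edge⊆V j E old i∈E)
  ... | inj₂ h′ with Equivalence.to (Bool.T-∨ {isNewEdge j E}) h′
  ...   | inj₁ new = toWitness (proj₁ (Equivalence.to (Bool.T-∧ {⌊ E ⊆? Vset k (suc j) ⌋})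
                                   (proj₁ (Equivalence.to (Bool.T-∧ {inBinom k (suc j) E}) new))))
  ...   | inj₂ E≡M =
    subst (_⊆ Vset k (suc j)) (sym (toWitness E≡M)) (interval⊆below {a = k * j} {k * suc j})

  Mset⊈below : ∀ {n t} j → k * j ≤ t → t < k * suc j → t < n → ¬ (Mset {n} k j ⊆ below t)
  Mset⊈below j kj≤t t<kj+k t<n M⊆ =
    ℕ.<-irrefl (toℕ-fromℕ< t<n) (∈-below⁻ (M⊆ (∈-interval⁺ (≤-toℕ kj≤t) (<-toℕ t<kj+k))))
    where
    ≤-toℕ = subst (k * j ≤_) (sym (toℕ-fromℕ< t<n))
    <-toℕ = subst (_< k * suc j) (sym (toℕ-fromℕ< t<n))

  isNewEdge≡ : ∀ {n} j (E : Subset n) →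
               isNewEdge j E ≡ inBinomOf (below (k * j + K)) k E ∧ not (inBinomOf (below (k * j)) k E)
  isNewEdge≡ j E = begin
    isNewEdge j E
      ≡⟨ rearrange ⌊ E ⊆? Vset k (suc j) ⌋ (∣ E ∣ ≡ᵇ k) _ (vertexIn (k * suc j) E) ⌊ E ⊆? below (k * j) ⌋
                   (λ E⊆V → nonempty?-interval (k * j) (k * suc j) E (toWitness E⊆V)) ⟩
    ((⌊ E ⊆? Vset k (suc j) ⌋ ∧ not (vertexIn (k * suc j) E)) ∧ (∣ E ∣ ≡ᵇ k))
      ∧ not (inBinomOf (below (k * j)) k E)
      ≡⟨ cong (λ x → (x ∧ (∣ E ∣ ≡ᵇ k)) ∧ not (inBinomOf (below (k * j)) k E)) last-vertex ⟨
    inBinomOf (below (k * j + K)) k E ∧ not (inBinomOf (below (k * j)) k E)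
      ∎
    where
    open ≡-Reasoning
    last-vertex : ⌊ E ⊆? below (k * j + K) ⌋ ≡ ⌊ E ⊆? Vset k (suc j) ⌋ ∧ not (vertexIn (k * suc j) E)
    last-vertex = subst (λ m → ⌊ E ⊆? below (k * j + K) ⌋ ≡ ⌊ E ⊆? below m ⌋ ∧ not (vertexIn m E))
                        (sym (*-suc-pred K j)) (⊆?-below-suc (k * j + K) E)
    rearrange : ∀ v s ne x p → (T v → ne ≡ not p) →
                (v ∧ s) ∧ (ne ∧ not x) ≡ ((v ∧ not x) ∧ s) ∧ not (p ∧ s)
    rearrange false s ne x p _  = refl
    rearrange true  s ne x p eq rewrite eq _ = rearrange′ s p x
      where
      rearrange′ : ∀ s p x → s ∧ (not p ∧ not x) ≡ (not x ∧ s) ∧ not (p ∧ s)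
      rearrange′ false p     true  = refl
      rearrange′ false true  false = refl
      rearrange′ false false false = refl
      rearrange′ true  true  true  = refl
      rearrange′ true  true  false = refl
      rearrange′ true  false true  = refl
      rearrange′ true  false false = refl

  isNewEdge⁻ : ∀ {n} j (E : Subset n) → T (isNewEdge j E) →
               E ⊆ below (k * j + K) × ¬ (E ⊆ below (k * j))
  isNewEdge⁻ j E h
    with Equivalence.to (Bool.T-∧ {inBinomOf (below (k * j + K)) k E}) (subst T (isNewEdge≡ j E) h)
  ... | inB , notInA with Equivalence.to (Bool.T-∧ {⌊ E ⊆? below (k * j + K) ⌋}) inB
  ...   | E⊆B , size = toWitness E⊆B , λ E⊆A →
    T-not⁻ notInA (Equivalence.from Bool.T-∧ (fromWitness {a? = E ⊆? below (k * j)} E⊆A , size))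

  count-isEdge-suc : ∀ {n} j → k * suc j ≤ n →
    count n (isEdge k (suc j)) + choose (k * j) k ≡ count n (isEdge k j) + suc (choose (k * j + K) k)
  count-isEdge-suc {n} j kj+k≤n = begin
    count n (isEdge k (suc j)) + choose (k * j) k
      ≡⟨ cong (_+ choose (k * j) k)
              (count-∨ n (isEdge k j) (λ E → isNewEdge j E ∨ isMset j E) old-disjoint) ⟩
    (old + count n (λ E → isNewEdge j E ∨ isMset j E)) + choose (k * j) k
      ≡⟨ cong (λ x → (old + x) + choose (k * j) k) (count-∨ n (isNewEdge j) (isMset j) new-disjoint) ⟩
    (old + (new + count n (isMset j))) + choose (k * j) k
      ≡⟨ cong (λ x → (old + (new + x)) + choose (k * j) k) (count-≡ (Mset {n} k j)) ⟩
    (old + (new + 1)) + choose (k * j) k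
      ≡⟨ reorder old new (choose (k * j) k) ⟩
    old + suc (new + choose (k * j) k)
      ≡⟨ cong (λ x → old + suc x) count-new ⟩
    old + suc (choose (k * j + K) k)
      ∎
    where
    open ≡-Reasoning
    old new : ℕ
    old = count n (isEdge k j)
    new = count n (isNewEdge j)
    reorder : ∀ a b c → (a + (b + 1)) + c ≡ a + suc (b + c)
    reorder = ℕ-Solver.solve-∀
    kj+K<kj+k : k * j + K < k * suc j
    kj+K<kj+k = subst (k * j + K <_) (sym (*-suc-pred K j)) (ℕ.n<1+n (k * j + K))
    kj<kj+k : k * j < k * suc j
    kj<kj+k = ℕ.≤-<-trans (ℕ.m≤m+n (k * j) K) kj+K<kj+k
    kj<n : k * j < n
    kj<n = ℕ.<-≤-trans kj<kj+k kj+k≤n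
    kj+K<n : k * j + K < n
    kj+K<n = ℕ.<-≤-trans kj+K<kj+k kj+k≤n
    count-new : new + choose (k * j) k ≡ choose (k * j + K) k
    count-new = begin
      new + choose (k * j) k
        ≡⟨ cong₂ _+_ (count-cong n (isNewEdge≡ j))
                     (cong (λ m → choose m k) (sym (∣below∣ (ℕ.<⇒≤ kj<n)))) ⟩
      count n (λ E → inBinomOf (below (k * j + K)) k E ∧ not (inBinomOf (below (k * j)) k E))
        + choose (∣ below {n} (k * j) ∣) k
        ≡⟨ count-inBinomOf-diff {n} k (below-mono (ℕ.m≤m+n (k * j) K)) ⟩
      choose (∣ below {n} (k * j + K) ∣) k
        ≡⟨ cong (λ m → choose m k) (∣below∣ (ℕ.<⇒≤ kj+K<n)) ⟩
      choose (k * j + K) k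
        ∎
    old-disjoint : ∀ E → T (isEdge k j E) → ¬ T (isNewEdge j E ∨ isMset j E)
    old-disjoint E isOld h with Equivalence.to (Bool.T-∨ {isNewEdge j E}) h
    ... | inj₁ isNew = proj₂ (isNewEdge⁻ j E isNew) (edge⊆V j E isOld)
    ... | inj₂ E≡M   =
      Mset⊈below j ℕ.≤-refl kj<kj+k kj<n (subst (_⊆ Vset k j) (toWitness E≡M) (edge⊆V j E isOld))
    new-disjoint : ∀ E → T (isNewEdge j E) → ¬ T (isMset j E)
    new-disjoint E isNew E≡M =
      Mset⊈below j (ℕ.m≤m+n (k * j) K) kj+K<kj+k kj+K<n
                 (subst (_⊆ below (k * j + K)) (toWitness E≡M) (proj₁ (isNewEdge⁻ j E isNew)))

  open Sequences K

  edgeCount≡closedForm : ∀ {n} j → k * j ≤ n → + count n (isEdge k j) ≡ closedForm j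
  edgeCount≡closedForm {n} zero    _ =
    trans (cong +_ (count-false n))
          (sym (trans (ℤ.+-identityˡ _) (∑-zero k (λ s → ℤ.*-zeroʳ (+ s *ᶻ ê s)))))
  edgeCount≡closedForm {n} (suc j) kj+k≤n = ∙-cancelʳ (c j) _ _ (begin
    + count n (isEdge k (suc j)) +ᶻ c j
      ≡⟨ ℤ.pos-+ (count n (isEdge k (suc j))) (choose (k * j) k) ⟨
    + (count n (isEdge k (suc j)) + choose (k * j) k)
      ≡⟨ cong +_ (count-isEdge-suc j kj+k≤n) ⟩
    + (count n (isEdge k j) + suc (choose (k * j + K) k))
      ≡⟨ ℤ.pos-+ (count n (isEdge k j)) (suc (choose (k * j + K) k)) ⟩
    + count n (isEdge k j) +ᶻ + suc (choose (k * j + K) k)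
      ≡⟨ cong (_+ᶻ + suc (choose (k * j + K) k)) (edgeCount≡closedForm j kj≤n) ⟩
    closedForm j +ᶻ + suc (choose (k * j + K) k)
      ≡⟨ closedForm-suc j ⟨
    closedForm (suc j) +ᶻ c j
      ∎)
    where
    open ≡-Reasoning
    kj≤n : k * j ≤ n
    kj≤n = ℕ.≤-trans (ℕ.*-monoʳ-≤ k (ℕ.n≤1+n j)) kj+k≤n

claim1 : (k m : ℕ) → 2 ≤ k → 1 ≤ m → (+ numEdges k m) / 1 ≡ f k m
claim1 (suc K) m (s≤s _) _ = begin
  + numEdges (suc K) m / 1
    ≡⟨ cong (λ x → + x / 1) (length-filter-allSubsets (suc K * m) (isEdge (suc K) m)) ⟩
  + count (suc K * m) (isEdge (suc K) m) / 1
    ≡⟨ cong (_/ 1) (edgeCount≡closedForm m ℕ.≤-refl) ⟩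
  closedForm m / 1
    ≡⟨ f≡closedForm m ⟨
  f (suc K) m
    ∎
  where
  open ≡-Reasoning
  open Hypergraph K
  open Sequences K
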